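{- Let $\gamma$ be a binary partial graph with marks in $\{O,L,R,X\}$, and let $\alpha$ be a sequence of nodes containing every node of $\gamma/_{L,R}$. Then for all nodes $p,t$: $$\mathit{inset}(\gamma,\alpha\cdot p)=\mathit{inset}(\gamma,\alpha)\qquad\text{and}\qquad \mathit{restore}(\gamma,\alpha\cdot p,t)=\mathit{restore}(\gamma,\alpha,p).$$
   Context: Nodes are natural numbers with $0=\mathrm{null}$. A binary partial graph with marks in $M=\{O,L,R,X\}$ is a finite partial map $\gamma$ from nodes (undefined at $\mathrm{null}$) to $M\times(\mathrm{node}\times\mathrm{node})$, $\gamma\,x=(\gamma_{val}\,x,[l,r])$. $\gamma/_{L,R}$ is $\gamma$ restricted to nodes marked $L$ or $R$. For $g:\mathrm{node}\to M\times(\mathrm{node}\times\mathrm{node})\to\mathrm{node}\times\mathrm{node}$, $\mathit{map}\ g\ \gamma$ is the unit-typed graph with the same domain mapping $x$ to $g\ x\ (\gamma\,x)$. $\mathit{ifmark}\ f\ x\ (m,[l,r])$ is $[f\,x,r]$ if $m=L$, $[l,f\,x]$ if $m=R$, $[l,r]$ otherwise. $\cdot$ denotes prepending/appending an element to a sequence. $\mathit{prev}\ (\mathrm{null}\cdot\alpha)\ x$ is the predecessor of the first occurrence of $x$ in $\mathrm{null}\cdot\alpha$ if $x\in\alpha$, and $\mathrm{null}$ otherwise; $\mathit{next}\ (\alpha\cdot t)\ x$ is the successor of the first occurrence of $x$ in $\alpha\cdot t$ if $x\in\alpha$, and $t$ otherwise. $\mathit{inset}(\gamma,\alpha)=\mathit{map}\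 (\mathit{ifmark}\ (\mathit{prev}\ (\mathrm{null}\cdot\alpha)))\ \gamma$; $\mathit{restore}(\gamma,\alpha,t)=\mathit{map}\ (\mathit{ifmark}\ (\mathit{next}\ (\alpha\cdot t)))\ \gamma$. -}

module Defs where

open import Data.Nat using (ℕ; zero; suc; _≟_; _≤_)
open import Data.Maybe using (Maybe; just; nothing)
open import Data.Product using (_×_; _,_; Σ)
open import Data.Sum using (_⊎_)
open import Data.List using (List; []; _∷_)
open import Data.List.Membership.Propositional using (_∈_)
open import Data.Unit using (⊤; tt)
open import Relation.Nullary using (yes; no)
open import Relation.Binary.PropositionalEquality using (_≡_)

Node : Set
Node = ℕ

null : Node
null = 0

data Mark : Set where
  O L R X : Mark

RawGraph : Set → Set
RawGraph A = Node → Maybe (A × (Node × Node))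

record PartialGraph (A : Set) : Set where
  field
    graph  : RawGraph A
    nullUndef : graph null ≡ nothing
    finite : Σ ℕ λ b → ∀ x → b ≤ x → graph x ≡ nothing
open PartialGraph public

_≐_ : ∀ {A} → RawGraph A → RawGraph A → Set
g ≐ h = ∀ x → g x ≡ h x

mapG : ∀ {A} → (Node → A × (Node × Node) → Node × Node) → RawGraph A → RawGraph ⊤
mapG g γ x with γ x
... | nothing = nothing
... | just v  = just (tt , g x v)

ifmark : (Node → Node) → Node → Mark × (Node × Node) → Node × Node
ifmark f x (L , (l , r)) = (f x , r)
ifmark f x (R , (l , r)) = (l , f x)
ifmark f x (O , lr) = lr
ifmark f x (X , lr) = lr

-- prevFrom p α x : predecessor of the first occurrence of x in p·α (if x ∈ α), else null
prevFrom : Node → List Node → Node → Node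
prevFrom p [] x = null
prevFrom p (y ∷ ys) x with x ≟ y
... | yes _ = p
... | no _  = prevFrom y ys x

-- prev (null·α) x
prev : List Node → Node → Node
prev α x = prevFrom null α x

-- next (α·t) x : successor of the first occurrence of x in α·t if x ∈ α, else t
next : List Node → Node → Node → Node
next [] t x = t
next (y ∷ ys) t x with x ≟ y
... | yes _ = headOr ys
  where
    headOr : List Node → Node
    headOr [] = t
    headOr (z ∷ _) = z
... | no _ = next ys t x

_▷_ : List Node → Node → List Node
[] ▷ p = p ∷ []
(y ∷ ys) ▷ p = y ∷ (ys ▷ p)

inset : PartialGraph Mark → List Node → RawGraph ⊤
inset γ α = mapG (ifmark (prev α)) (graph γ)

restore : PartialGraph Mark → List Node → Node → RawGraph ⊤
restore γ α t = mapG (ifmark (next α t)) (graph γ)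

CoversLR : PartialGraph Mark → List Node → Set
CoversLR γ α = ∀ x m l r → graph γ x ≡ just (m , (l , r)) → (m ≡ L ⊎ m ≡ R) → x ∈ α

-- inset and restore consult prev and next only at nodes marked L or R, all of
-- which lie in α; and on α, prev (null·α·p) agrees with prev (null·α) while
-- next (α·p·t) agrees with next (α·p).
module Submission where

open import Defs
open import Data.Empty using (⊥-elim)
open import Data.List using (List; []; _∷_)
open import Data.List.Membership.Propositional using (_∈_)
open import Data.List.Relation.Unary.Any using (here; there)
open import Data.Maybe using (just; nothing)
open import Data.Nat using (_≟_)
open import Data.Product using (_×_; _,_)
open import Data.Sum using (_⊎_; inj₁; inj₂)
open import Data.Unit using (tt)
open import Relation.Nullary using (yes; no)
open import Relation.Binary.PropositionalEquality using (_≡_; refl; cong)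

prevFrom-▷ : ∀ q α p {x} → x ∈ α → prevFrom q (α ▷ p) x ≡ prevFrom q α x
prevFrom-▷ q (y ∷ ys) p {x} x∈ with x ≟ y
prevFrom-▷ q (y ∷ ys) p _            | yes _   = refl
prevFrom-▷ q (y ∷ ys) p (here x≡y)   | no x≢y  = ⊥-elim (x≢y x≡y)
prevFrom-▷ q (y ∷ ys) p (there x∈ys) | no _    = prevFrom-▷ y ys p x∈ys

next-▷ : ∀ α p t {x} → x ∈ α → next (α ▷ p) t x ≡ next α p x
next-▷ (y ∷ ys) p t {x} x∈ with x ≟ y
next-▷ (y ∷ [])     p t _            | yes _  = refl
next-▷ (y ∷ z ∷ ys) p t _            | yes _  = refl
next-▷ (y ∷ ys)     p t (here x≡y)   | no x≢y = ⊥-elim (x≢y x≡y)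
next-▷ (y ∷ ys)     p t (there x∈ys) | no _   = next-▷ ys p t x∈ys

mapG-cong : ∀ {A} {g h : Node → A × (Node × Node) → Node × Node} (γ : RawGraph A) →
  (∀ x v → γ x ≡ just v → g x v ≡ h x v) → mapG g γ ≐ mapG h γ
mapG-cong γ g≗h x with γ x in γx≡
... | nothing = refl
... | just v  = cong (λ lr → just (tt , lr)) (g≗h x v γx≡)

ifmark-cong : ∀ {f g : Node → Node} x m l r → (m ≡ L ⊎ m ≡ R → f x ≡ g x) →
  ifmark f x (m , (l , r)) ≡ ifmark g x (m , (l , r))
ifmark-cong x O l r _     = refl
ifmark-cong x L l r fx≡gx = cong (_, r) (fx≡gx (inj₁ refl))
ifmark-cong x R l r fx≡gx = cong (l ,_) (fx≡gx (inj₂ refl))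
ifmark-cong x X l r _     = refl

mapG-ifmark-cong : ∀ (γ : PartialGraph Mark) α {f g : Node → Node} → CoversLR γ α →
  (∀ {x} → x ∈ α → f x ≡ g x) →
  mapG (ifmark f) (graph γ) ≐ mapG (ifmark g) (graph γ)
mapG-ifmark-cong γ α covers f≗g = mapG-cong (graph γ) λ where
  x (m , (l , r)) γx≡ → ifmark-cong x m l r (λ m∈LR → f≗g (covers x m l r γx≡ m∈LR))

lemma5p3 : (γ : PartialGraph Mark) (α : List Node) → CoversLR γ α →
    ∀ (p t : Node) →
      (inset γ (α ▷ p) ≐ inset γ α) × (restore γ (α ▷ p) t ≐ restore γ α p)
lemma5p3 γ α covers p t =
    mapG-ifmark-cong γ α covers (prevFrom-▷ null α p)
  , mapG-ifmark-cong γ α covers (next-▷ α p t)
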